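{- Let $R$ be an integral domain with $1$, let $d\ge 0$ and let $p(t)=a_0+a_1t+\cdots+a_dt^d\in R[t]$ have degree $d$ with $a_0\neq 0$. For $k\ge 0$ define $C_{i,k}$ by $\frac{(tp(t))^k}{1-t^{d+1}}=\sum_{i\ge0}C_{i,k}t^i$. Let $V_{p(t)}$ be the $(d+1)\times(d+1)$ circulant matrix $$V_{p(t)}=\begin{pmatrix} a_d & a_{d-1} & \cdots & a_1 & a_0\\ a_0 & a_{d} & \cdots & a_2 & a_1\\ \vdots & \vdots & \ddots & \vdots & \vdots\\ a_{d-2} & a_{d-3} & \cdots & a_d & a_{d-1}\\ a_{d-1} & a_{d-2} & \cdots & a_0 & a_d \end{pmatrix},$$ whose $i$-th row ($i=0,\dots,d$) is $T^i(a_d,a_{d-1},\dots,a_0)$ with $T(x_d,x_{d-1},\dots,x_1,x_0)=(x_0,x_d,x_{d-1},\dots,x_1)$. Then for every integer $n\ge 0$, $$V_{p(t)}^n\begin{pmatrix}a_0\\ a_1\\ \vdots\\ a_d\end{pmatrix}=\begin{pmatrix}C_{1+n(d+1),\,n+1}\\ C_{1+n(d+1)+1,\,n+1}\\ \vdots\\ C_{1+n(d+1)+d,\,n+1}\end{pmatrix}.$$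
   Context: $C_{i,k}$ is the entry in row $i$, column $k$ (indexed from $0$) of the Riordan array $\bigl(1/(1-t^{d+1}),\,tp(t)\bigr)$, the infinite lower triangular matrix whose $k$-th column has generating function $(tp(t))^k/(1-t^{d+1})$. -}

module Defs where

open import Level using (Level; _⊔_)
open import Algebra.Bundles using (CommutativeRing)
open import Data.Nat using (ℕ; zero; suc; _∸_; _%_; _<?_; _≟_)
open import Data.Fin using (Fin; fromℕ<; toℕ; fromℕ; inject₁)
import Data.Fin as F
open import Data.Product using (_×_)
open import Data.Sum using (_⊎_)
open import Relation.Nullary using (¬_; yes; no)
open import Relation.Binary.PropositionalEquality using (_≡_)

module _ {c ℓ : Level} (R : CommutativeRing c ℓ) where
  open CommutativeRing R hiding (zero)

  IsIntegralDomain : Set (c ⊔ ℓ)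
  IsIntegralDomain = (¬ (1# ≈ 0#)) × (∀ x y → x * y ≈ 0# → (x ≈ 0#) ⊎ (y ≈ 0#))

  sumUpTo : (ℕ → Carrier) → ℕ → Carrier
  sumUpTo f zero    = f zero
  sumUpTo f (suc i) = sumUpTo f i + f (suc i)

  sumFin : ∀ {n} → (Fin n → Carrier) → Carrier
  sumFin {zero}  f = 0#
  sumFin {suc n} f = f F.zero + sumFin (λ j → f (F.suc j))

  _⊛_ : (ℕ → Carrier) → (ℕ → Carrier) → (ℕ → Carrier)
  (f ⊛ g) i = sumUpTo (λ j → f j * g (i ∸ j)) i

  oneS : ℕ → Carrier
  oneS zero    = 1#
  oneS (suc _) = 0#

  powS : (ℕ → Carrier) → ℕ → (ℕ → Carrier)
  powS f zero    = oneS
  powS f (suc k) = f ⊛ powS f k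

  polyS : ∀ d → (Fin (suc d) → Carrier) → ℕ → Carrier
  polyS d a j with j <? suc d
  ... | yes j<d+1 = a (fromℕ< j<d+1)
  ... | no _      = 0#

  tpS : ∀ d → (Fin (suc d) → Carrier) → ℕ → Carrier
  tpS d a zero    = 0#
  tpS d a (suc j) = polyS d a j

  -- coefficient sequence of 1/(1 - t^{d+1}) = Σ_m t^{m(d+1)}
  geomS : ℕ → ℕ → Carrier
  geomS d j with j % suc d ≟ 0
  ... | yes _ = 1#
  ... | no _  = 0#

  C : ∀ d → (Fin (suc d) → Carrier) → ℕ → ℕ → Carrier
  C d a i k = (geomS d ⊛ powS (tpS d a) k) i

  -- cyclic shift T(x_d, x_{d-1}, ..., x_1, x_0) = (x_0, x_d, ..., x_1),
  -- vectors written by position 0..d from the left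
  T : ∀ {d} → (Fin (suc d) → Carrier) → (Fin (suc d) → Carrier)
  T {d} x F.zero    = x (fromℕ d)
  T {d} x (F.suc j) = x (inject₁ j)

  iterate : ∀ {A : Set c} → (A → A) → ℕ → A → A
  iterate g zero    x = x
  iterate g (suc n) x = g (iterate g n x)

  row0 : ∀ d → (Fin (suc d) → Carrier) → Fin (suc d) → Carrier
  row0 d a j = a (F.opposite j)

  V : ∀ d → (Fin (suc d) → Carrier) → Fin (suc d) → Fin (suc d) → Carrier
  V d a i = iterate T (toℕ i) (row0 d a)

  mulMV : ∀ {n} → (Fin n → Fin n → Carrier) → (Fin n → Carrier) → (Fin n → Carrier)
  mulMV M v i = sumFin (λ j → M i j * v j)

{-# OPTIONS --safe #-}
-- Write g = 1/(1 - t^(d+1)) and q = t p(t), and let H_n = g q^(n+1), so that the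
-- right-hand side is the window H_n[1 + n(d+1) + i], 0 ≤ i ≤ d.  Multiplication by g
-- is characterised by the recurrence X = f + t^(d+1) X, hence commutes with
-- multiplication by any series.  Since q^(n+1) has degree (n+1)(d+1), the recurrence
-- makes H_n periodic with period d+1 beyond index n(d+1), so the window determines
-- all later coefficients of H_n.  The window of H_(n+1) = q H_n is then a cyclic
-- convolution of the coefficients of p with the window of H_n, which is exactly the
-- product with the circulant matrix V_p.
module Submission where

open import Defs
open import Algebra.Bundles using (CommutativeRing)
open import Data.Nat using (ℕ; zero; suc; _+_; _*_; _∸_; _%_; _/_; _≤_; _<_; z≤n; s≤s; _<?_; _≤?_; _≟_)
import Data.Nat.Properties as ℕₚ
open import Data.Nat.DivMod using (m%n<n; m≡m%n+[m/n]*n; [m+kn]%n≡m%n; [m+n]%n≡m%n; m<n⇒m%n≡m)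
open import Algebra.Properties.CommutativeSemigroup ℕₚ.+-commutativeSemigroup
  using () renaming (x∙yz≈y∙xz to m+[n+o]≡n+[m+o])
open import Data.Nat.Induction using (<-rec)
open import Data.Fin using (Fin; toℕ; fromℕ; fromℕ<)
import Data.Fin as F
import Data.Fin.Properties as Fₚ
open import Data.Empty using (⊥-elim)
open import Function using (_∘_)
open import Relation.Nullary using (¬_; yes; no)
open import Relation.Binary.PropositionalEquality as ≡ using (_≡_)

module Coefficients {c ℓ} (R : CommutativeRing c ℓ) where
  open CommutativeRing R hiding (zero) renaming (_+_ to _⊕_; _*_ to _⊗_)
  open import Algebra.Properties.AbelianGroup +-abelianGroup using (∙-cancelˡ)
  open import Algebra.Properties.CommutativeSemigroup +-commutativeSemigroup using (interchange)
  open import Relation.Binary.Reasoning.Setoid setoid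

  Σ : (ℕ → Carrier) → ℕ → Carrier
  Σ = sumUpTo R

  _⋆_ : (ℕ → Carrier) → (ℕ → Carrier) → ℕ → Carrier
  _⋆_ = _⊛_ R

  Σ-cong : ∀ {f g} n → (∀ m → m ≤ n → f m ≈ g m) → Σ f n ≈ Σ g n
  Σ-cong zero    f≈g = f≈g 0 z≤n
  Σ-cong (suc n) f≈g = +-cong (Σ-cong n (λ m m≤n → f≈g m (ℕₚ.m≤n⇒m≤1+n m≤n))) (f≈g (suc n) ℕₚ.≤-refl)

  Σ-zero : ∀ {f} n → (∀ m → m ≤ n → f m ≈ 0#) → Σ f n ≈ 0#
  Σ-zero n f≈0 = trans (Σ-cong n f≈0) (Σ-const0 n)
    where
    Σ-const0 : ∀ n → Σ (λ _ → 0#) n ≈ 0#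
    Σ-const0 zero    = refl
    Σ-const0 (suc n) = trans (+-identityʳ _) (Σ-const0 n)

  Σ-head : ∀ f n → Σ f (suc n) ≈ f 0 ⊕ Σ (f ∘ suc) n
  Σ-head f zero    = refl
  Σ-head f (suc n) = trans (+-congʳ (Σ-head f n)) (+-assoc _ _ _)

  Σ-head-only : ∀ f n → (∀ m → m < n → f (suc m) ≈ 0#) → Σ f n ≈ f 0
  Σ-head-only f zero    _   = refl
  Σ-head-only f (suc n) f≈0 = begin
    Σ f (suc n)          ≈⟨ Σ-head f n ⟩
    f 0 ⊕ Σ (f ∘ suc) n  ≈⟨ +-congˡ (Σ-zero n (λ m m≤n → f≈0 m (s≤s m≤n))) ⟩
    f 0 ⊕ 0#             ≈⟨ +-identityʳ _ ⟩
    f 0                  ∎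

  Σ-split : ∀ f m e → Σ f (m + suc e) ≈ Σ f m ⊕ Σ (λ u → f (suc (m + u))) e
  Σ-split f m zero    rewrite ℕₚ.+-suc m 0 | ℕₚ.+-identityʳ m = refl
  Σ-split f m (suc e) rewrite ℕₚ.+-suc m (suc e) =
    trans (+-congʳ (Σ-split f m e)) (+-assoc _ _ _)

  Σ-padʳ : ∀ f n e → (∀ m → n < m → f m ≈ 0#) → Σ f (n + e) ≈ Σ f n
  Σ-padʳ f n zero    _   rewrite ℕₚ.+-identityʳ n = refl
  Σ-padʳ f n (suc e) f≈0 rewrite ℕₚ.+-suc n e =
    trans (+-cong (Σ-padʳ f n e f≈0) (f≈0 _ (s≤s (ℕₚ.m≤m+n n e)))) (+-identityʳ _)

  Σ-reverse : ∀ f n → Σ f n ≈ Σ (λ m → f (n ∸ m)) n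
  Σ-reverse f zero    = refl
  Σ-reverse f (suc n) = begin
    Σ f n ⊕ f (suc n)                  ≈⟨ +-comm _ _ ⟩
    f (suc n) ⊕ Σ f n                  ≈⟨ +-congˡ (Σ-reverse f n) ⟩
    f (suc n) ⊕ Σ (λ m → f (n ∸ m)) n  ≈⟨ Σ-head (λ m → f (suc n ∸ m)) n ⟨
    Σ (λ m → f (suc n ∸ m)) (suc n)    ∎

  Σ-distrib-⊕ : ∀ f g n → Σ (λ m → f m ⊕ g m) n ≈ Σ f n ⊕ Σ g n
  Σ-distrib-⊕ f g zero    = refl
  Σ-distrib-⊕ f g (suc n) =
    trans (+-congʳ (Σ-distrib-⊕ f g n)) (interchange (Σ f n) (Σ g n) (f (suc n)) (g (suc n)))

  Σ-rotate : ∀ d f → (∀ m → f (suc d + m) ≈ f m) → ∀ r → Σ (λ j → f (r + j)) d ≈ Σ f d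
  Σ-rotate d f periodic zero    = refl
  Σ-rotate d f periodic (suc r) = trans (∙-cancelˡ (f r) _ _ shift-by-one) (Σ-rotate d f periodic r)
    where
    shift-by-one : f r ⊕ Σ (λ j → f (suc r + j)) d ≈ f r ⊕ Σ (λ j → f (r + j)) d
    shift-by-one = begin
      f r ⊕ Σ (λ j → f (suc r + j)) d      ≈⟨ +-cong (reflexive (≡.cong f (ℕₚ.+-identityʳ r)))
                                                      (Σ-cong d (λ j _ → reflexive (≡.cong f (ℕₚ.+-suc r j)))) ⟨
      f (r + 0) ⊕ Σ (λ j → f (r + suc j)) d ≈⟨ Σ-head (λ j → f (r + j)) d ⟨
      Σ (λ j → f (r + j)) d ⊕ f (r + suc d) ≈⟨ +-congˡ (trans (reflexive (≡.cong f (ℕₚ.+-comm r (suc d)))) (periodic r)) ⟩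
      Σ (λ j → f (r + j)) d ⊕ f r           ≈⟨ +-comm _ _ ⟩
      f r ⊕ Σ (λ j → f (r + j)) d           ∎

  sumFin≈Σ : ∀ n (f : Fin (suc n) → Carrier) g → (∀ k → g (toℕ k) ≈ f k) → sumFin R f ≈ Σ g n
  sumFin≈Σ zero    f g g≈f = trans (+-identityʳ _) (sym (g≈f F.zero))
  sumFin≈Σ (suc n) f g g≈f =
    trans (+-cong (sym (g≈f F.zero)) (sumFin≈Σ n (f ∘ F.suc) (g ∘ suc) (g≈f ∘ F.suc))) (sym (Σ-head g n))

  ⋆-congʳ : ∀ f {h h′} → (∀ m → h m ≈ h′ m) → ∀ j → (f ⋆ h) j ≈ (f ⋆ h′) j
  ⋆-congʳ f h≈h′ j = Σ-cong j (λ u _ → *-congˡ (h≈h′ (j ∸ u)))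

  ⋆-distribˡ-⊕ : ∀ f h h′ j → (f ⋆ (λ m → h m ⊕ h′ m)) j ≈ (f ⋆ h) j ⊕ (f ⋆ h′) j
  ⋆-distribˡ-⊕ f h h′ j = trans (Σ-cong j (λ u _ → distribˡ _ _ _)) (Σ-distrib-⊕ _ _ j)

  ⋆-identityʳ : ∀ f j → (f ⋆ oneS R) j ≈ f j
  ⋆-identityʳ f zero    = *-identityʳ _
  ⋆-identityʳ f (suc j) = begin
    Σ (λ u → f u ⊗ oneS R (suc j ∸ u)) j ⊕ f (suc j) ⊗ oneS R (j ∸ j)
      ≈⟨ +-cong (Σ-zero j (λ u u≤j → trans (*-congˡ (reflexive (≡.cong (oneS R) (ℕₚ.+-∸-assoc 1 u≤j)))) (zeroʳ _)))
                (*-congˡ (reflexive (≡.cong (oneS R) (ℕₚ.n∸n≡0 j)))) ⟩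
    0# ⊕ f (suc j) ⊗ 1#  ≈⟨ trans (+-identityˡ _) (*-identityʳ _) ⟩
    f (suc j)            ∎

  VanishesAbove : ℕ → (ℕ → Carrier) → Set ℓ
  VanishesAbove n f = ∀ m → n < m → f m ≈ 0#

  ⋆-vanishesAbove : ∀ {f h} m n → VanishesAbove m f → VanishesAbove n h → VanishesAbove (m + n) (f ⋆ h)
  ⋆-vanishesAbove {f} {h} m n f≈0 h≈0 j m+n<j = Σ-zero j (λ u _ → term u)
    where
    term : ∀ u → f u ⊗ h (j ∸ u) ≈ 0#
    term u with u ≤? m
    ... | yes u≤m = trans (*-congˡ (h≈0 (j ∸ u) n<j∸u)) (zeroʳ _)
      where
      n<j∸u : n < j ∸ u
      n<j∸u = ℕₚ.<-≤-trans (ℕₚ.≤-reflexive (≡.sym (ℕₚ.m+n∸m≡n u (suc n))))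
                (ℕₚ.∸-monoˡ-≤ u (ℕₚ.≤-trans (ℕₚ.≤-reflexive (ℕₚ.+-suc u n)) (ℕₚ.≤-trans (s≤s (ℕₚ.+-monoˡ-≤ n u≤m)) m+n<j)))
    ... | no  u≰m = trans (*-congʳ (f≈0 u (ℕₚ.≰⇒> u≰m))) (zeroˡ _)

  shift : ℕ → (ℕ → Carrier) → ℕ → Carrier
  shift zero    h j       = h j
  shift (suc m) h zero    = 0#
  shift (suc m) h (suc j) = shift m h j

  shift-< : ∀ m h j → j < m → shift m h j ≡ 0#
  shift-< (suc m) h zero    _         = ≡.refl
  shift-< (suc m) h (suc j) (s≤s j<m) = shift-< m h j j<m

  shift-+ : ∀ m h e → shift m h (m + e) ≡ h e
  shift-+ zero    h e = ≡.refl
  shift-+ (suc m) h e = shift-+ m h e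

  shift-cong-≤ : ∀ m {h h′} j → (∀ k → k ≤ j → h k ≈ h′ k) → shift m h j ≈ shift m h′ j
  shift-cong-≤ zero    j       h≈h′ = h≈h′ j ℕₚ.≤-refl
  shift-cong-≤ (suc m) zero    h≈h′ = refl
  shift-cong-≤ (suc m) (suc j) h≈h′ = shift-cong-≤ m j (λ k k≤j → h≈h′ k (ℕₚ.m≤n⇒m≤1+n k≤j))

  shift-≤ : ∀ m h j → j ≤ m → h 0 ≈ 0# → shift m h j ≈ 0#
  shift-≤ zero    h zero    _         h₀≈0 = h₀≈0
  shift-≤ (suc m) h zero    _         _    = refl
  shift-≤ (suc m) h (suc j) (s≤s j≤m) h₀≈0 = shift-≤ m h j j≤m h₀≈0

  ⋆-shift : ∀ m f h j → (f ⋆ shift (suc m) h) j ≈ shift (suc m) (f ⋆ h) j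
  ⋆-shift m f h j with j <? suc m
  ... | yes j<1+m = trans (Σ-zero j (λ u _ → trans (*-congˡ (reflexive
                                (shift-< (suc m) h (j ∸ u) (ℕₚ.≤-<-trans (ℕₚ.m∸n≤m j u) j<1+m)))) (zeroʳ _)))
                          (reflexive (≡.sym (shift-< (suc m) (f ⋆ h) j j<1+m)))
  ... | no  j≮1+m rewrite ≡.sym (ℕₚ.m+[n∸m]≡n (ℕₚ.≮⇒≥ j≮1+m)) =
    trans (⋆-shift-+ (j ∸ suc m)) (reflexive (≡.sym (shift-+ (suc m) (f ⋆ h) (j ∸ suc m))))
    where
    ⋆-shift-+ : ∀ e → (f ⋆ shift (suc m) h) (suc m + e) ≈ (f ⋆ h) e
    ⋆-shift-+ e = begin
      Σ F (suc m + e)                          ≡⟨ ≡.cong (Σ F) (ℕₚ.+-comm (suc m) e) ⟩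
      Σ F (e + suc m)                          ≈⟨ Σ-split F e m ⟩
      Σ F e ⊕ Σ (λ u → F (suc (e + u))) m      ≈⟨ +-cong low high ⟩
      (f ⋆ h) e ⊕ 0#                           ≈⟨ +-identityʳ _ ⟩
      (f ⋆ h) e                                ∎
      where
      F : ℕ → Carrier
      F u = f u ⊗ shift (suc m) h (suc m + e ∸ u)
      low : Σ F e ≈ (f ⋆ h) e
      low = Σ-cong e (λ u u≤e → *-congˡ (reflexive
              (≡.trans (≡.cong (shift (suc m) h) (ℕₚ.+-∸-assoc (suc m) u≤e)) (shift-+ (suc m) h (e ∸ u)))))
      high : Σ (λ u → F (suc (e + u))) m ≈ 0#
      high = Σ-zero m (λ u _ → trans (*-congˡ (reflexive (≡.trans
               (≡.cong (shift (suc m) h) (≡.trans (≡.cong (_∸ (e + u)) (ℕₚ.+-comm m e)) (ℕₚ.[m+n]∸[m+o]≡n∸o e m u)))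
               (shift-< (suc m) h (m ∸ u) (s≤s (ℕₚ.m∸n≤m m u)))))) (zeroʳ _))

  -- X = f + t^(m+1) X determines X coefficientwise, each coefficient from earlier ones.
  shift-fixpoint-unique : ∀ m (f X Y : ℕ → Carrier) → (∀ j → X j ≈ f j ⊕ shift (suc m) X j) →
                          (∀ j → Y j ≈ f j ⊕ shift (suc m) Y j) → ∀ j → X j ≈ Y j
  shift-fixpoint-unique m f X Y X≈ Y≈ = <-rec (λ j → X j ≈ Y j) step
    where
    earlier : ∀ j → (∀ {k} → k < j → X k ≈ Y k) → shift (suc m) X j ≈ shift (suc m) Y j
    earlier zero    _   = refl
    earlier (suc j) X≈Y = shift-cong-≤ m j (λ k k≤j → X≈Y (s≤s k≤j))
    step : ∀ j → (∀ {k} → k < j → X k ≈ Y k) → X j ≈ Y j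
    step j X≈Y = trans (X≈ j) (trans (+-congˡ (earlier j X≈Y)) (sym (Y≈ j)))

  module Geometric (d : ℕ) where

    D : ℕ
    D = suc d

    g : ℕ → Carrier
    g = geomS R d

    geomS-cong-% : ∀ j j′ → j % D ≡ j′ % D → g j ≈ g j′
    geomS-cong-% j j′ j≡j′ with j % D ≟ 0 | j′ % D ≟ 0
    ... | yes _   | yes _   = refl
    ... | no  _   | no  _   = refl
    ... | yes j≡0 | no  j′≢0 = ⊥-elim (j′≢0 (≡.trans (≡.sym j≡j′) j≡0))
    ... | no  j≢0 | yes j′≡0 = ⊥-elim (j≢0 (≡.trans j≡j′ j′≡0))

    geomS-periodic : ∀ u → g (D + u) ≈ g u
    geomS-periodic u = geomS-cong-% (D + u) u (≡.trans (≡.cong (_% D) (ℕₚ.+-comm D u)) ([m+n]%n≡m%n u D))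

    geomS-inner : ∀ u → u < d → g (suc u) ≈ 0#
    geomS-inner u u<d with suc u % D ≟ 0
    ... | yes 1+u≡0 = ⊥-elim (ℕₚ.1+n≢0 (≡.trans (≡.sym (m<n⇒m%n≡m (s≤s u<d))) 1+u≡0))
    ... | no  _     = refl

    geom⋆-< : ∀ f j → j < D → (g ⋆ f) j ≈ f j
    geom⋆-< f j j<D = trans (Σ-head-only _ j (λ u u<j → trans (*-congʳ (geomS-inner u (ℕₚ.<-≤-trans u<j (ℕₚ.≤-pred j<D)))) (zeroˡ _)))
                            (*-identityˡ _)

    geom⋆-+D : ∀ f e → (g ⋆ f) (D + e) ≈ f (D + e) ⊕ (g ⋆ f) e
    geom⋆-+D f e = begin
      Σ F (suc d + e)                      ≡⟨ ≡.cong (Σ F) (≡.sym (ℕₚ.+-suc d e)) ⟩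
      Σ F (d + suc e)                      ≈⟨ Σ-split F d e ⟩
      Σ F d ⊕ Σ (λ u → F (suc (d + u))) e  ≈⟨ +-cong first-period rest ⟩
      f (D + e) ⊕ (g ⋆ f) e                ∎
      where
      F : ℕ → Carrier
      F u = g u ⊗ f (D + e ∸ u)
      first-period : Σ F d ≈ f (D + e)
      first-period = trans (Σ-head-only F d (λ u u<d → trans (*-congʳ (geomS-inner u u<d)) (zeroˡ _))) (*-identityˡ _)
      rest : Σ (λ u → F (suc (d + u))) e ≈ (g ⋆ f) e
      rest = Σ-cong e (λ u _ → *-cong (geomS-periodic u) (reflexive (≡.cong f (ℕₚ.[m+n]∸[m+o]≡n∸o D e u))))

    geom⋆-fixpoint : ∀ f j → (g ⋆ f) j ≈ f j ⊕ shift D (g ⋆ f) j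
    geom⋆-fixpoint f j with j <? D
    ... | yes j<D = trans (geom⋆-< f j j<D)
                      (trans (sym (+-identityʳ _)) (+-congˡ (reflexive (≡.sym (shift-< D _ j j<D)))))
    ... | no  j≮D rewrite ≡.sym (ℕₚ.m+[n∸m]≡n (ℕₚ.≮⇒≥ j≮D)) =
      trans (geom⋆-+D f (j ∸ D)) (+-congˡ (reflexive (≡.sym (shift-+ D (g ⋆ f) (j ∸ D)))))

    geom⋆-≤ : ∀ f j → f 0 ≈ 0# → j ≤ D → (g ⋆ f) j ≈ f j
    geom⋆-≤ f j f₀≈0 j≤D = trans (geom⋆-fixpoint f j)
      (trans (+-congˡ (shift-≤ D (g ⋆ f) j j≤D (trans (*-identityˡ _) f₀≈0))) (+-identityʳ _))

    geom⋆-⋆-comm : ∀ h f j → (g ⋆ (h ⋆ f)) j ≈ (h ⋆ (g ⋆ f)) j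
    geom⋆-⋆-comm h f = shift-fixpoint-unique d (h ⋆ f) (g ⋆ (h ⋆ f)) (h ⋆ (g ⋆ f)) (geom⋆-fixpoint (h ⋆ f)) fixpoint
      where
      fixpoint : ∀ j → (h ⋆ (g ⋆ f)) j ≈ (h ⋆ f) j ⊕ shift D (h ⋆ (g ⋆ f)) j
      fixpoint j = begin
        (h ⋆ (g ⋆ f)) j                              ≈⟨ ⋆-congʳ h (geom⋆-fixpoint f) j ⟩
        (h ⋆ (λ m → f m ⊕ shift D (g ⋆ f) m)) j      ≈⟨ ⋆-distribˡ-⊕ h f (shift D (g ⋆ f)) j ⟩
        (h ⋆ f) j ⊕ (h ⋆ shift D (g ⋆ f)) j          ≈⟨ +-congˡ (⋆-shift d h (g ⋆ f) j) ⟩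
        (h ⋆ f) j ⊕ shift D (h ⋆ (g ⋆ f)) j          ∎

    periodic-% : ∀ (X : ℕ → Carrier) b → (∀ m → X (b + (D + m)) ≈ X (b + m)) → ∀ m → X (b + m % D) ≈ X (b + m)
    periodic-% X b periodic m = begin
      X (b + m % D)                   ≈⟨ periods (m / D) (m % D) ⟨
      X (b + (m % D + m / D * D))     ≡⟨ ≡.cong (λ z → X (b + z)) (≡.sym (m≡m%n+[m/n]*n m D)) ⟩
      X (b + m)                       ∎
      where
      periods : ∀ k r → X (b + (r + k * D)) ≈ X (b + r)
      periods zero    r = reflexive (≡.cong (λ z → X (b + z)) (ℕₚ.+-identityʳ r))
      periods (suc k) r = begin
        X (b + (r + (D + k * D)))  ≡⟨ ≡.cong (λ z → X (b + z)) (m+[n+o]≡n+[m+o] r D (k * D)) ⟩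
        X (b + (D + (r + k * D)))  ≈⟨ periodic (r + k * D) ⟩
        X (b + (r + k * D))        ≈⟨ periods k r ⟩
        X (b + r)                  ∎

    wrap : (Fin D → Carrier) → ℕ → Carrier
    wrap y m = y (fromℕ< (m%n<n m D))

    wrap-% : ∀ y m m′ → m % D ≡ m′ % D → wrap y m ≡ wrap y m′
    wrap-% y m m′ m%D≡m′%D = ≡.cong y (Fₚ.fromℕ<-cong _ _ m%D≡m′%D _ _)

    wrap-toℕ : ∀ y k → wrap y (toℕ k) ≡ y k
    wrap-toℕ y k = ≡.cong y (≡.trans (Fₚ.fromℕ<-cong _ _ (m<n⇒m%n≡m (Fₚ.toℕ<n k)) _ (Fₚ.toℕ<n k)) (Fₚ.fromℕ<-toℕ k _))

    wrap-periodic : ∀ y m → wrap y (D + m) ≡ wrap y m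
    wrap-periodic y m = wrap-% y (D + m) m (≡.trans (≡.cong (_% D) (ℕₚ.+-comm D m)) ([m+n]%n≡m%n m D))

    -- T^i x at position j is x at position j - i (mod D), and -i ≡ i d (mod D).
    iterate-T : ∀ i x j → iterate R (T R) i x j ≈ wrap x (toℕ j + i * d)
    iterate-T zero    x j         = reflexive (≡.sym (≡.trans (≡.cong (wrap x) (ℕₚ.+-identityʳ (toℕ j))) (wrap-toℕ x j)))
    iterate-T (suc i) x F.zero    = trans (iterate-T i x (fromℕ d))
                                          (reflexive (≡.cong (λ z → wrap x (z + i * d)) (Fₚ.toℕ-fromℕ d)))
    iterate-T (suc i) x (F.suc j) = begin
      iterate R (T R) i x (F.inject₁ j)   ≈⟨ iterate-T i x (F.inject₁ j) ⟩
      wrap x (toℕ (F.inject₁ j) + i * d)  ≡⟨ ≡.cong (λ z → wrap x (z + i * d)) (Fₚ.toℕ-inject₁ j) ⟩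
      wrap x (toℕ j + i * d)              ≡⟨ wrap-periodic x (toℕ j + i * d) ⟨
      wrap x (D + (toℕ j + i * d))        ≡⟨ ≡.cong (wrap x ∘ suc) (m+[n+o]≡n+[m+o] d (toℕ j) (i * d)) ⟩
      wrap x (suc (toℕ j) + suc i * d)    ∎


    module _ (a : Fin D → Carrier) where

      p q : ℕ → Carrier
      p = polyS R d a
      q = tpS R d a

      polyS-toℕ : ∀ k → p (toℕ k) ≡ a k
      polyS-toℕ k with toℕ k <? D
      ... | yes k<D = ≡.cong a (Fₚ.fromℕ<-toℕ k k<D)
      ... | no  k≮D = ⊥-elim (k≮D (Fₚ.toℕ<n k))

      polyS-vanishesAbove : VanishesAbove d p
      polyS-vanishesAbove m d<m with m <? D
      ... | yes m<D = ⊥-elim (ℕₚ.<⇒≱ d<m (ℕₚ.≤-pred m<D))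
      ... | no  _   = refl

      tpS-vanishesAbove : VanishesAbove D q
      tpS-vanishesAbove (suc m) (s≤s d<m) = polyS-vanishesAbove m d<m

      powS-vanishesAbove : ∀ k → VanishesAbove (k * D) (powS R q k)
      powS-vanishesAbove zero    (suc m) _ = refl
      powS-vanishesAbove (suc k) = ⋆-vanishesAbove D (k * D) tpS-vanishesAbove (powS-vanishesAbove k)

      tpS⋆-coefficient : ∀ h e → (q ⋆ h) (suc (d + e)) ≈ Σ (λ u → p u ⊗ h (e + (d ∸ u))) d
      tpS⋆-coefficient h e = begin
        Σ F (suc (d + e))              ≈⟨ Σ-head F (d + e) ⟩
        F 0 ⊕ Σ (F ∘ suc) (d + e)      ≈⟨ +-cong (zeroˡ _) (Σ-padʳ (F ∘ suc) d e
                                               (λ m d<m → trans (*-congʳ (polyS-vanishesAbove m d<m)) (zeroˡ _))) ⟩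
        0# ⊕ Σ (F ∘ suc) d             ≈⟨ +-identityˡ _ ⟩
        Σ (F ∘ suc) d                  ≈⟨ Σ-cong d (λ u u≤d → *-congˡ (reflexive (≡.cong h
                                            (≡.trans (≡.cong (_∸ u) (ℕₚ.+-comm d e)) (ℕₚ.+-∸-assoc e u≤d))))) ⟩
        Σ (λ u → p u ⊗ h (e + (d ∸ u))) d ∎
        where
        F : ℕ → Carrier
        F u = q u ⊗ h (suc (d + e) ∸ u)

      wrap-row0 : ∀ j → j ≤ d → wrap (row0 R d a) j ≡ p (d ∸ j)
      wrap-row0 j j≤d = ≡.trans (≡.cong (wrap (row0 R d a)) (≡.sym (Fₚ.toℕ-fromℕ< (s≤s j≤d))))
        (≡.trans (wrap-toℕ (row0 R d a) k)
          (≡.trans (≡.sym (polyS-toℕ (F.opposite k)))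
            (≡.cong p (≡.trans (Fₚ.opposite-prop k) (≡.cong (d ∸_) (Fₚ.toℕ-fromℕ< (s≤s j≤d)))))))
        where
        k = fromℕ< (s≤s j≤d)

      -- Rotating the summation by i lines row i of V up with row 0; reversing it then
      -- turns the coefficients a_d, ..., a_0 of row 0 into p_0, ..., p_d.
      mulMV-V : ∀ y i → mulMV R (V R d a) y i ≈ Σ (λ l → p l ⊗ wrap y (toℕ i + (d ∸ l))) d
      mulMV-V y i = begin
        mulMV R (V R d a) y i          ≈⟨ sumFin≈Σ d _ F (λ k → *-cong (sym (iterate-T (toℕ i) (row0 R d a) k))
                                                                      (reflexive (wrap-toℕ y k))) ⟩
        Σ F d                          ≈⟨ Σ-rotate d F F-periodic (toℕ i) ⟨
        Σ (λ j → F (toℕ i + j)) d      ≈⟨ Σ-cong d (λ j j≤d → *-congʳ (reflexive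
                                            (≡.trans (wrap-% (row0 R d a) (toℕ i + j + toℕ i * d) j (row-index j)) (wrap-row0 j j≤d)))) ⟩
        Σ F′ d                         ≈⟨ Σ-reverse F′ d ⟩
        Σ (λ l → F′ (d ∸ l)) d         ≈⟨ Σ-cong d (λ l l≤d → *-congʳ (reflexive (≡.cong p (ℕₚ.m∸[m∸n]≡n l≤d)))) ⟩
        Σ (λ l → p l ⊗ wrap y (toℕ i + (d ∸ l))) d ∎
        where
        F F′ : ℕ → Carrier
        F m = wrap (row0 R d a) (m + toℕ i * d) ⊗ wrap y m
        F′ j = p (d ∸ j) ⊗ wrap y (toℕ i + j)
        F-periodic : ∀ m → F (D + m) ≈ F m
        F-periodic m = *-cong (reflexive (≡.trans (≡.cong (wrap (row0 R d a)) (ℕₚ.+-assoc D m (toℕ i * d)))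
                                                  (wrap-periodic (row0 R d a) (m + toℕ i * d))))
                              (reflexive (wrap-periodic y m))
        row-index : ∀ j → (toℕ i + j + toℕ i * d) % D ≡ j % D
        row-index j = ≡.trans (≡.cong (_% D) (≡.trans (ℕₚ.+-assoc (toℕ i) j (toℕ i * d))
                                (≡.trans (m+[n+o]≡n+[m+o] (toℕ i) j (toℕ i * d))
                                  (≡.cong (j +_) (≡.sym (ℕₚ.*-suc (toℕ i) d))))))
                        ([m+kn]%n≡m%n j (toℕ i) D)

      H : ℕ → ℕ → Carrier
      H n = g ⋆ powS R q (suc n)

      -- The recurrence H(D + m) = q^(n+1)(D + m) + H m loses its first term once D + m exceeds
      -- the degree (n+1)D.
      H-periodic : ∀ n m → H n (suc (n * D) + (D + m)) ≈ H n (suc (n * D) + m)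
      H-periodic n m = begin
        H n (suc (n * D) + (D + m))                ≡⟨ ≡.cong (H n ∘ suc) (m+[n+o]≡n+[m+o] (n * D) D m) ⟩
        H n (suc (D + (n * D + m)))                ≡⟨ ≡.cong (H n ∘ suc) (ℕₚ.+-suc d (n * D + m)) ⟨
        H n (D + (suc (n * D) + m))                ≈⟨ geom⋆-+D (powS R q (suc n)) (suc (n * D) + m) ⟩
        powS R q (suc n) (D + suc (n * D + m)) ⊕ H n (suc (n * D) + m)
          ≈⟨ +-congʳ (powS-vanishesAbove (suc n) _ (ℕₚ.+-monoʳ-< D (s≤s (ℕₚ.m≤m+n (n * D) m)))) ⟩
        0# ⊕ H n (suc (n * D) + m)                 ≈⟨ +-identityˡ _ ⟩
        H n (suc (n * D) + m)                      ∎

      H-wrap : ∀ n y → (∀ k → y k ≈ H n (suc (n * D + toℕ k))) → ∀ m → wrap y m ≈ H n (suc (n * D + m))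
      H-wrap n y y≈H m = begin
        wrap y m                         ≈⟨ y≈H _ ⟩
        H n (suc (n * D + toℕ k))        ≡⟨ ≡.cong (λ z → H n (suc (n * D + z))) (Fₚ.toℕ-fromℕ< (m%n<n m D)) ⟩
        H n (suc (n * D) + m % D)        ≈⟨ periodic-% (H n) (suc (n * D)) (H-periodic n) m ⟩
        H n (suc (n * D + m))            ∎
        where
        k = fromℕ< (m%n<n m D)

      iterate-V : ∀ n i → iterate R (mulMV R (V R d a)) n a i ≈ H n (suc (n * D + toℕ i))
      iterate-V zero    i = sym (begin
        (g ⋆ (q ⋆ oneS R)) (suc (toℕ i))  ≈⟨ geom⋆-≤ (q ⋆ oneS R) (suc (toℕ i)) (zeroˡ _) (Fₚ.toℕ<n i) ⟩
        (q ⋆ oneS R) (suc (toℕ i))        ≈⟨ ⋆-identityʳ q (suc (toℕ i)) ⟩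
        p (toℕ i)                         ≡⟨ polyS-toℕ i ⟩
        a i                               ∎)
      iterate-V (suc n) i = begin
        mulMV R (V R d a) y i                           ≈⟨ mulMV-V y i ⟩
        Σ (λ l → p l ⊗ wrap y (toℕ i + (d ∸ l))) d      ≈⟨ Σ-cong d (λ l _ → *-congˡ (trans (H-wrap n y (iterate-V n) _)
                                                             (reflexive (≡.cong (H n ∘ suc) (≡.sym (ℕₚ.+-assoc (n * D) (toℕ i) (d ∸ l))))))) ⟩
        Σ (λ l → p l ⊗ H n (e + (d ∸ l))) d             ≈⟨ tpS⋆-coefficient (H n) e ⟨
        (q ⋆ H n) (suc (d + e))                         ≈⟨ geom⋆-⋆-comm q (powS R q (suc n)) (suc (d + e)) ⟨
        H (suc n) (suc (d + e))                         ≡⟨ ≡.cong (H (suc n) ∘ suc) (≡.trans (ℕₚ.+-suc d (n * D + toℕ i))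
                                                             (≡.cong suc (≡.sym (ℕₚ.+-assoc d (n * D) (toℕ i))))) ⟩
        H (suc n) (suc (suc n * D + toℕ i))             ∎
        where
        y = iterate R (mulMV R (V R d a)) n a
        e = suc (n * D + toℕ i)

theorem2 : ∀ {c ℓ} (R : CommutativeRing c ℓ) → IsIntegralDomain R →
    (d : ℕ) (a : Fin (suc d) → CommutativeRing.Carrier R) →
    ¬ (CommutativeRing._≈_ R (a (fromℕ d)) (CommutativeRing.0# R)) →
    ¬ (CommutativeRing._≈_ R (a F.zero) (CommutativeRing.0# R)) →
    (n : ℕ) (i : Fin (suc d)) →
    CommutativeRing._≈_ R
    (iterate R (mulMV R (V R d a)) n a i)
    (C R d a (1 + n * suc d + toℕ i) (suc n))
theorem2 R _ d a _ _ = Coefficients.Geometric.iterate-V R d a
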